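{- Let $W$ be a finite set with $\{1,2,3,4\}\subseteq W\subseteq\{1,2,\ldots,n\}$. Let $\mathcal F_W^2$ be the set of forests with vertex set $W$ having exactly two connected components. Let $\mathcal F'_W$ be the set of $T\sqcup T'\in\mathcal F_W^2$ (with $T,T'$ its two components) such that $\{1,2\},\{2,3\}\in E(T)$ and $4\in V(T')$, and let $\mathcal F''_W$ be the set of $T\sqcup T'\in\mathcal F_W^2$ such that $\{1,2\}\in E(T)$ and $\{3,4\}\in E(T')$. Then $\#\mathcal F'_W=\#\mathcal F''_W$.
   Context: A forest with vertex set $W$ is a spanning acyclic subgraph of the complete graph on $W$; $E(\cdot)$ and $V(\cdot)$ denote edge and vertex sets. -}

module Defs where

open import Data.Nat using (ℕ; _+_; _≤_)
open import Data.Bool using (Bool; true; false; T)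
open import Data.Fin using (Fin; zero; suc)
open import Data.Fin.Subset using (Subset; _∈_)
open import Data.Vec using (Vec; lookup)
open import Data.List using (List; []; _∷_; length; _∷ʳ_)
open import Data.List.Relation.Unary.Linked using (Linked)
open import Data.List.Relation.Unary.Unique.Propositional using (Unique)
open import Data.Product using (Σ; ∃; _×_)
open import Data.Sum using (_⊎_)
open import Relation.Nullary using (¬_)
open import Relation.Binary.PropositionalEquality using (_≡_)
open import Relation.Binary.Construct.Closure.ReflexiveTransitive using (Star)

-- Vertices {1,…,n} are represented by Fin n, vertex i ↦ index i-1.
-- A (simple) graph on {1,…,n}: its adjacency matrix.  Symmetry and
-- irreflexivity are imposed in IsGraph, so each graph has a unique representation.
Graph : ℕ → Set
Graph N = Vec (Vec Bool N) N

adj : ∀ {N} → Graph N → Fin N → Fin N → Bool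
adj G i j = lookup (lookup G i) j

Edge : ∀ {N} → Graph N → Fin N → Fin N → Set
Edge G i j = T (adj G i j)

IsGraph : ∀ {N} → Graph N → Set
IsGraph G = (∀ i j → adj G i j ≡ adj G j i) × (∀ i → adj G i i ≡ false)

-- all edges lie inside W (so G is a graph with vertex set W;
-- vertices outside W are not vertices of the graph)
EdgesIn : ∀ {N} → Subset N → Graph N → Set
EdgesIn W G = ∀ i j → Edge G i j → (i ∈ W) × (j ∈ W)

Cycle : ∀ {N} → Graph N → Set
Cycle {N} G = Σ (Fin N) λ v → Σ (List (Fin N)) λ ws →
  (3 ≤ length (v ∷ ws)) × Unique (v ∷ ws) × Linked (Edge G) ((v ∷ ws) ∷ʳ v)

Acyclic : ∀ {N} → Graph N → Set
Acyclic G = ¬ Cycle G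

Conn : ∀ {N} → Graph N → Fin N → Fin N → Set
Conn G = Star (Edge G)

TwoComponents : ∀ {N} → Subset N → Graph N → Set
TwoComponents {N} W G = Σ (Fin N) λ a → Σ (Fin N) λ b →
  (a ∈ W) × (b ∈ W) × ¬ Conn G a b × (∀ v → v ∈ W → Conn G a v ⊎ Conn G b v)

InF2 : ∀ {N} → Subset N → Graph N → Set
InF2 W G = IsGraph G × EdgesIn W G × Acyclic G × TwoComponents W G

v1 v2 v3 v4 : ∀ {k} → Fin (4 + k)
v1 = zero
v2 = suc zero
v3 = suc (suc zero)
v4 = suc (suc (suc zero))

-- 𝓕'_W : T ⊔ T' ∈ 𝓕²_W with {1,2},{2,3} ∈ E(T) and 4 ∈ V(T'),
-- i.e. 4 lies in the other component than the one containing 1,2,3.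
InF' : ∀ {k} → Subset (4 + k) → Graph (4 + k) → Set
InF' W G = InF2 W G × Edge G v1 v2 × Edge G v2 v3 × ¬ Conn G v1 v4

-- 𝓕''_W : T ⊔ T' ∈ 𝓕²_W with {1,2} ∈ E(T) and {3,4} ∈ E(T'),
-- i.e. the components of these two edges differ.
InF'' : ∀ {k} → Subset (4 + k) → Graph (4 + k) → Set
InF'' W G = InF2 W G × Edge G v1 v2 × Edge G v3 v4 × ¬ Conn G v1 v3

-- Toggling the two edges 3—2 and 3—4 (taking the symmetric difference with the
-- path 2—3—4) is an involution exchanging 𝓕'_W and 𝓕''_W.  In a forest with two
-- components, deleting an edge {a,b} splits its component into a part A ∋ a and
-- a part B ∋ b; inserting {a,c} for a vertex c of the other component merges A
-- with that component and creates no cycle.  So the result is again a forest with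
-- two components, now with a and b in different ones.  For G ∈ 𝓕'_W this applies
-- with (a,b,c) = (3,2,4), for G ∈ 𝓕''_W with (a,b,c) = (3,4,2).
module Submission where

open import Defs
open import Data.Bool using (Bool; true; false; T; _∧_; _∨_; _xor_)
open import Data.Bool.Properties using (∧-comm; ∨-comm; xor-assoc; xor-same; xor-identityʳ; T-∧; T-∨)
open import Data.Empty using (⊥-elim)
open import Data.Fin using (Fin; zero; suc; _≟_)
open import Data.Fin.Subset using (Subset; _∈_)
open import Data.List using (List; []; _∷_; _++_; _∷ʳ_; [_]; length; initLast; _∷ʳ′_)
open import Data.List.Properties using (++-assoc)
open import Data.List.Membership.Propositional using () renaming (_∈_ to _∈ₗ_)
open import Data.List.Membership.Propositional.Properties using (∈-∃++)
import Data.List.Membership.DecPropositional as DecMembership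
import Data.List.Relation.Binary.Permutation.Setoid.Properties as Permutation
open import Data.List.Relation.Unary.All using (All; []; _∷_)
open import Data.List.Relation.Unary.All.Properties using (¬Any⇒All¬; ∷ʳ⁺; ∷ʳ⁻)
open import Data.List.Relation.Unary.AllPairs using ([]; _∷_)
open import Data.List.Relation.Unary.Any using (here)
open import Data.List.Relation.Unary.Linked as Linked using (Linked; []; [-]; _∷_)
open import Data.List.Relation.Unary.Unique.Propositional using (Unique)
open import Data.Nat using (ℕ; _+_; _≤_; s≤s; z≤n)
open import Data.Nat.Properties using (suc-injective)
open import Data.Product using (Σ; _×_; _,_; proj₁; proj₂; map₁)
open import Data.Refinement as Refinement using (Refinement; value; value-injective)
open import Data.Sum using (_⊎_; inj₁; inj₂)
import Data.Sum as Sum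
open import Data.Vec using (tabulate; lookup)
open import Data.Vec.Properties using (lookup∘tabulate; tabulate∘lookup; tabulate-cong)
open import Function.Base using (_∘_)
open import Function.Bundles using (_↔_; mk↔ₛ′; Equivalence)
open import Level using (0ℓ)
open import Relation.Binary.Core using (Rel; _⇒_)
open import Relation.Binary.Definitions using (Symmetric; DecidableEquality)
open import Relation.Binary.Construct.Union using (_∪_)
open import Relation.Binary.Construct.Closure.ReflexiveTransitive as Star using (Star; ε; _◅_; _◅◅_; reverse)
open import Relation.Binary.PropositionalEquality using (_≡_; _≢_; refl; sym; trans; cong; cong₂; subst; setoid; module ≡-Reasoning)
open import Relation.Nullary using (¬_; yes; no)
open import Relation.Nullary.Decidable using (T?)

module _ {A : Set} where

  IsPair : A → A → Rel A 0ℓ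
  IsPair a b x y = (x ≡ a × y ≡ b) ⊎ (x ≡ b × y ≡ a)

  ClosedPath : Rel A 0ℓ → A → List A → Set
  ClosedPath R v ws = Unique (v ∷ ws) × Linked R ((v ∷ ws) ∷ʳ v)

  Cyclic : Rel A 0ℓ → Set
  Cyclic R = Σ A λ v → Σ (List A) λ ws → 3 ≤ length (v ∷ ws) × ClosedPath R v ws

  StarVia : Rel A 0ℓ → A → A → Rel A 0ℓ
  StarVia H a b x y = Star H x y ⊎ (Star H x a × Star H b y) ⊎ (Star H x b × Star H a y)

  SimplePath : Rel A 0ℓ → A → A → Set
  SimplePath R x y = Σ (List A) λ ws → Unique (x ∷ (ws ∷ʳ y)) × Linked R (x ∷ (ws ∷ʳ y))

  1≤length-∷ʳ : ∀ xs {y : A} → 1 ≤ length (xs ∷ʳ y)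
  1≤length-∷ʳ []      = s≤s z≤n
  1≤length-∷ʳ (_ ∷ _) = s≤s z≤n

  Unique-++⁻ʳ : ∀ xs {ys : List A} → Unique (xs ++ ys) → Unique ys
  Unique-++⁻ʳ []       u       = u
  Unique-++⁻ʳ (_ ∷ xs) (_ ∷ u) = Unique-++⁻ʳ xs u

module _ {A : Set} {R : Rel A 0ℓ} where

  Linked-++⁻ʳ : ∀ xs {ys : List A} → Linked R (xs ++ ys) → Linked R ys
  Linked-++⁻ʳ []       l = l
  Linked-++⁻ʳ (_ ∷ xs) l = Linked-++⁻ʳ xs (Linked.tail l)

  Linked-++⁻ : ∀ xs {y ys} → Linked R (xs ++ y ∷ ys) → Linked R (xs ∷ʳ y) × Linked R (y ∷ ys)
  Linked-++⁻ []            l       = [-] , l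
  Linked-++⁻ (x ∷ [])      (r ∷ l) = r ∷ [-] , l
  Linked-++⁻ (x ∷ x′ ∷ xs) (r ∷ l) = map₁ (r ∷_) (Linked-++⁻ (x′ ∷ xs) l)

  Linked-++⁺ : ∀ xs {y ys} → Linked R (xs ∷ʳ y) → Linked R (y ∷ ys) → Linked R (xs ++ y ∷ ys)
  Linked-++⁺ []            _        l = l
  Linked-++⁺ (x ∷ [])      (r ∷ _)  l = r ∷ l
  Linked-++⁺ (x ∷ x′ ∷ xs) (r ∷ l₁) l = r ∷ Linked-++⁺ (x′ ∷ xs) l₁ l

  Linked-∷ʳ⁻ : ∀ xs {y z} → Linked R ((xs ∷ʳ y) ∷ʳ z) → Linked R (xs ∷ʳ y) × R y z
  Linked-∷ʳ⁻ xs {y} {z} l with Linked-++⁻ xs (subst (Linked R) (++-assoc xs [ y ] [ z ]) l)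
  ... | l₁ , r ∷ [-] = l₁ , r

  Linked-∷ʳ⁺ : ∀ xs {y z} → Linked R (xs ∷ʳ y) → R y z → Linked R ((xs ∷ʳ y) ∷ʳ z)
  Linked-∷ʳ⁺ xs {y} {z} l r = subst (Linked R) (sym (++-assoc xs [ y ] [ z ])) (Linked-++⁺ xs l (r ∷ [-]))

  Linked⇒Star : ∀ {x} xs {y} → Linked R (x ∷ (xs ∷ʳ y)) → Star R x y
  Linked⇒Star []       (r ∷ _) = r ◅ ε
  Linked⇒Star (_ ∷ xs) (r ∷ l) = r ◅ Linked⇒Star xs l

  ClosedPath-rotate : ∀ {a v ws} → a ∈ₗ v ∷ ws → ClosedPath R v ws →
                      Σ (List A) λ r → ClosedPath R a r × length r ≡ length ws
  ClosedPath-rotate {ws = ws} a∈ cp with ∈-∃++ a∈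
  ... | [] , _ , refl = ws , cp , refl
  ClosedPath-rotate {a} {v} _ (u , l) | _ ∷ p , q , refl =
    q ++ v ∷ p , (Unique-resp-↭ rotation u , l′) , suc-injective (sym (xs↭ys⇒|xs|≡|ys| rotation))
    where
    open Permutation (setoid A) using (Unique-resp-↭; ++-comm; xs↭ys⇒|xs|≡|ys|)
    open import Data.List.Relation.Binary.Permutation.Setoid (setoid A) using (_↭_)
    rotation : (v ∷ p) ++ a ∷ q ↭ (a ∷ q) ++ v ∷ p
    rotation = ++-comm (v ∷ p) (a ∷ q)
    l′ : Linked R ((a ∷ (q ++ v ∷ p)) ∷ʳ a)
    l′ with Linked-++⁻ (v ∷ p) (subst (Linked R) (++-assoc (v ∷ p) (a ∷ q) [ v ]) l)
    ... | v⋯a , a⋯v = subst (Linked R ∘ (a ∷_)) (sym (++-assoc q (v ∷ p) [ a ]))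
                              (Linked-++⁺ (a ∷ q) a⋯v v⋯a)

module _ {A : Set} (_≟ᴬ_ : DecidableEquality A) where
  open DecMembership _≟ᴬ_ using (_∈?_)

  -- Loop erasure: when x reappears on the path from the next vertex, cut back to it.
  Star⇒SimplePath : ∀ {R : Rel A 0ℓ} {x y} → x ≢ y → Star R x y → SimplePath R x y
  Star⇒SimplePath x≢y ε = ⊥-elim (x≢y refl)
  Star⇒SimplePath {R} {x} {y} x≢y (_◅_ {j = z} r z⋯y) with z ≟ᴬ y
  ... | yes refl = [] , (x≢y ∷ []) ∷ [] ∷ [] , r ∷ [-]
  ... | no z≢y with Star⇒SimplePath z≢y z⋯y
  ...   | ws , u , l with x ∈? z ∷ ws
  ...     | no x∉ = z ∷ ws , ∷ʳ⁺ (¬Any⇒All¬ _ x∉) x≢y ∷ u , r ∷ l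
  ...     | yes x∈ with ∈-∃++ x∈
  ...       | p , q , eq =
    q , Unique-++⁻ʳ p (subst Unique split u) , Linked-++⁻ʳ p (subst (Linked R) split l)
    where
    split : z ∷ (ws ∷ʳ y) ≡ p ++ x ∷ (q ∷ʳ y)
    split = trans (cong (_∷ʳ y) eq) (++-assoc p (x ∷ q) [ y ])

  ¬Star-across-bridge : ∀ {R H : Rel A 0ℓ} {a b} → H ⇒ R → ¬ Cyclic R →
                        R b a → ¬ H a b → a ≢ b → ¬ Star H a b
  ¬Star-across-bridge H⇒R R-acyclic Rba ¬Hab a≢b a⋯b with Star⇒SimplePath a≢b a⋯b
  ... | [] , _ , Hab ∷ _ = ¬Hab Hab
  ... | w ∷ ws , u , l =
    R-acyclic (_ , w ∷ (ws ∷ʳ _) , s≤s (s≤s (1≤length-∷ʳ ws)) , u ,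
               Linked-∷ʳ⁺ (_ ∷ w ∷ ws) (Linked.map H⇒R l) Rba)

module _ {A : Set} {R H : Rel A 0ℓ} {a b : A} (R⇒ : R ⇒ H ∪ IsPair a b) where

  Star-split : Star R ⇒ StarVia H a b
  Star-split ε = inj₁ ε
  Star-split (r ◅ rs) with R⇒ r | Star-split rs
  ... | inj₁ h                    | inj₁ p              = inj₁ (h ◅ p)
  ... | inj₁ h                    | inj₂ (inj₁ (p , q)) = inj₂ (inj₁ (h ◅ p , q))
  ... | inj₁ h                    | inj₂ (inj₂ (p , q)) = inj₂ (inj₂ (h ◅ p , q))
  ... | inj₂ (inj₁ (refl , refl)) | inj₁ p              = inj₂ (inj₁ (ε , p))
  ... | inj₂ (inj₁ (refl , refl)) | inj₂ (inj₁ (_ , q)) = inj₂ (inj₁ (ε , q))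
  ... | inj₂ (inj₁ (refl , refl)) | inj₂ (inj₂ (_ , q)) = inj₁ q
  ... | inj₂ (inj₂ (refl , refl)) | inj₁ p              = inj₂ (inj₂ (ε , p))
  ... | inj₂ (inj₂ (refl , refl)) | inj₂ (inj₁ (_ , q)) = inj₁ q
  ... | inj₂ (inj₂ (refl , refl)) | inj₂ (inj₂ (_ , q)) = inj₂ (inj₂ (ε , q))

  Linked-avoiding : ∀ {xs} → All (a ≢_) xs → Linked R xs → Linked H xs
  Linked-avoiding _                  []      = []
  Linked-avoiding _                  [-]     = [-]
  Linked-avoiding (a≢x ∷ a≢xs@(a≢y ∷ _)) (r ∷ l) with R⇒ r
  ... | inj₁ h               = h ∷ Linked-avoiding a≢xs l
  ... | inj₂ (inj₁ (x≡a , _)) = ⊥-elim (a≢x (sym x≡a))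
  ... | inj₂ (inj₂ (_ , y≡a)) = ⊥-elim (a≢y (sym y≡a))

module _ {A : Set} (_≟ᴬ_ : DecidableEquality A) {R H : Rel A 0ℓ} {a b : A}
         (R⇒ : R ⇒ H ∪ IsPair a b) (H-sym : Symmetric H)
         (H-acyclic : ¬ Cyclic H) (a↮b : ¬ Star H a b) where
  open DecMembership _≟ᴬ_ using (_∈?_)

  private
    a≢b : a ≢ b
    a≢b refl = a↮b ε

  -- If one of the two edges at a is {a,b}, the rest of the cycle is an H-path
  -- between a and b; otherwise the whole cycle lies in H.
  ¬ClosedPath-through : ∀ r → 2 ≤ length r → ¬ ClosedPath R a r
  ¬ClosedPath-through r len cp with initLast r
  ¬ClosedPath-through .[] () _ | []
  ¬ClosedPath-through .([] ∷ʳ z) (s≤s ()) _ | [] ∷ʳ′ z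
  ¬ClosedPath-through .((r₁ ∷ m) ∷ʳ z) len (u@(a≢r ∷ r₁≢m ∷ _) , l) | (r₁ ∷ m) ∷ʳ′ z
    with Linked-∷ʳ⁻ (a ∷ r₁ ∷ m) l
  ... | a→r₁ ∷ r₁⋯z , z→a with Linked-avoiding R⇒ a≢r r₁⋯z
  ...   | r₁⋯zᴴ with R⇒ a→r₁ | R⇒ z→a
  ...     | inj₁ h₁ | inj₁ hₗ =
    H-acyclic (a , r₁ ∷ (m ∷ʳ z) , s≤s len , u , Linked-∷ʳ⁺ (a ∷ r₁ ∷ m) (h₁ ∷ r₁⋯zᴴ) hₗ)
  ...     | inj₂ (inj₁ (_ , r₁≡b)) | inj₁ hₗ =
    a↮b (subst (Star H a) r₁≡b (reverse H-sym (Linked⇒Star m r₁⋯zᴴ ◅◅ (hₗ ◅ ε))))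
  ...     | inj₁ h₁ | inj₂ (inj₂ (z≡b , _)) =
    a↮b (subst (Star H a) z≡b (h₁ ◅ Linked⇒Star m r₁⋯zᴴ))
  ...     | inj₂ (inj₁ (_ , r₁≡b)) | inj₂ (inj₂ (z≡b , _)) = proj₂ (∷ʳ⁻ r₁≢m) (trans r₁≡b (sym z≡b))
  ...     | inj₂ (inj₂ (a≡b , _)) | _ = a≢b a≡b
  ...     | _ | inj₂ (inj₁ (_ , a≡b)) = a≢b a≡b

  acyclic-join : ¬ Cyclic R
  acyclic-join (v , ws , s≤s len , cp@(u , l)) with a ∈? v ∷ ws
  ... | no a∉ =
    H-acyclic (v , ws , s≤s len , u , Linked-avoiding R⇒ (∷ʳ⁺ (¬Any⇒All¬ _ a∉) (a∉ ∘ here)) l)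
  ... | yes a∈ with ClosedPath-rotate a∈ cp
  ...   | r , cp′ , |r|≡|ws| = ¬ClosedPath-through r (subst (2 ≤_) (sym |r|≡|ws|) len) cp′

module GraphProperties {N : ℕ} (G : Graph N) (isG : IsGraph G) where

  Edge-sym : Symmetric (Edge G)
  Edge-sym {x} {y} = subst T (proj₁ isG x y)

  Conn-sym : Symmetric (Conn G)
  Conn-sym = reverse Edge-sym

  Edge-irrefl : ∀ {x y} → Edge G x y → x ≢ y
  Edge-irrefl {x} e refl = subst T (proj₂ isG x) e

  Edge-IsPair⁺ : ∀ {a b x y} → IsPair a b x y → Edge G a b → Edge G x y
  Edge-IsPair⁺ (inj₁ (refl , refl)) e = e
  Edge-IsPair⁺ (inj₂ (refl , refl)) e = Edge-sym e

  Edge-IsPair⁻ : ∀ {a b x y} → IsPair a b x y → Edge G x y → Edge G a b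
  Edge-IsPair⁻ (inj₁ (refl , refl)) e = e
  Edge-IsPair⁻ (inj₂ (refl , refl)) e = Edge-sym e

  TwoComponents-cover : ∀ {W x y} → TwoComponents W G → x ∈ W → y ∈ W → ¬ Conn G x y →
                        ∀ v → v ∈ W → Conn G x v ⊎ Conn G y v
  TwoComponents-cover (_ , _ , _ , _ , _ , cover) x∈W y∈W x↮y v v∈W
    with cover _ x∈W | cover _ y∈W | cover v v∈W
  ... | inj₁ a⋯x | inj₁ a⋯y | _        = ⊥-elim (x↮y (Conn-sym a⋯x ◅◅ a⋯y))
  ... | inj₂ b⋯x | inj₂ b⋯y | _        = ⊥-elim (x↮y (Conn-sym b⋯x ◅◅ b⋯y))
  ... | inj₁ a⋯x | inj₂ _   | inj₁ a⋯v = inj₁ (Conn-sym a⋯x ◅◅ a⋯v)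
  ... | inj₁ _   | inj₂ b⋯y | inj₂ b⋯v = inj₂ (Conn-sym b⋯y ◅◅ b⋯v)
  ... | inj₂ b⋯x | inj₁ _   | inj₂ b⋯v = inj₁ (Conn-sym b⋯x ◅◅ b⋯v)
  ... | inj₂ _   | inj₁ a⋯y | inj₁ a⋯v = inj₂ (Conn-sym a⋯y ◅◅ a⋯v)

T-xor⁻ : ∀ p q → T (p xor q) → (T p × ¬ T q) ⊎ (T q × ¬ T p)
T-xor⁻ true  false _ = inj₁ (_ , λ ())
T-xor⁻ false true  _ = inj₂ (_ , λ ())

T-xor⁺ˡ : ∀ p q → T p → ¬ T q → T (p xor q)
T-xor⁺ˡ true false _ _  = _
T-xor⁺ˡ true true  _ ¬q = ¬q _

T-xor⁺ʳ : ∀ p q → ¬ T p → T q → T (p xor q)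
T-xor⁺ʳ false true _  _ = _
T-xor⁺ʳ true  true ¬p _ = ¬p _

module _ {N : ℕ} where

  fromAdj : (Fin N → Fin N → Bool) → Graph N
  fromAdj f = tabulate λ i → tabulate λ j → f i j

  adj-fromAdj : ∀ f i j → adj (fromAdj f) i j ≡ f i j
  adj-fromAdj f i j = trans (cong (λ row → lookup row j) (lookup∘tabulate _ i)) (lookup∘tabulate _ j)

  fromAdj-adj : ∀ G → fromAdj (adj G) ≡ G
  fromAdj-adj G = trans (tabulate-cong λ i → tabulate∘lookup (lookup G i)) (tabulate∘lookup G)

  fromAdj-cong : ∀ {f g} → (∀ i j → f i j ≡ g i j) → fromAdj f ≡ fromAdj g
  fromAdj-cong f≡g = tabulate-cong λ i → tabulate-cong (f≡g i)

  IsGraph-fromAdj : ∀ {f} → (∀ i j → f i j ≡ f j i) → (∀ i → f i i ≡ false) → IsGraph (fromAdj f)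
  IsGraph-fromAdj {f} f-sym f-irrefl =
      (λ i j → trans (adj-fromAdj f i j) (trans (f-sym i j) (sym (adj-fromAdj f j i))))
    , (λ i → trans (adj-fromAdj f i i) (f-irrefl i))

  infixl 6 _△_
  _△_ : Graph N → Graph N → Graph N
  G △ S = fromAdj λ i j → adj G i j xor adj S i j

  △-cancelʳ : ∀ G S → G △ S △ S ≡ G
  △-cancelʳ G S = trans (fromAdj-cong twice-toggled) (fromAdj-adj G)
    where
    open ≡-Reasoning
    twice-toggled : ∀ i j → adj (G △ S) i j xor adj S i j ≡ adj G i j
    twice-toggled i j = begin
      adj (G △ S) i j xor adj S i j          ≡⟨ cong (_xor adj S i j) (adj-fromAdj _ i j) ⟩
      (adj G i j xor adj S i j) xor adj S i j ≡⟨ xor-assoc (adj G i j) _ _ ⟩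
      adj G i j xor (adj S i j xor adj S i j) ≡⟨ cong (adj G i j xor_) (xor-same (adj S i j)) ⟩
      adj G i j xor false                     ≡⟨ xor-identityʳ (adj G i j) ⟩
      adj G i j                               ∎

  IsGraph-△ : ∀ {G S} → IsGraph G → IsGraph S → IsGraph (G △ S)
  IsGraph-△ (G-sym , G-irrefl) (S-sym , S-irrefl) =
    IsGraph-fromAdj (λ i j → cong₂ _xor_ (G-sym i j) (S-sym i j))
                    (λ i → cong₂ _xor_ (G-irrefl i) (S-irrefl i))

  module _ (G S : Graph N) {x y : Fin N} where

    Edge-△⁻ : Edge (G △ S) x y → (Edge G x y × ¬ Edge S x y) ⊎ (Edge S x y × ¬ Edge G x y)
    Edge-△⁻ e = T-xor⁻ (adj G x y) (adj S x y) (subst T (adj-fromAdj _ x y) e)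

    Edge-△⁺ˡ : Edge G x y → ¬ Edge S x y → Edge (G △ S) x y
    Edge-△⁺ˡ g ¬s = subst T (sym (adj-fromAdj _ x y)) (T-xor⁺ˡ (adj G x y) (adj S x y) g ¬s)

    Edge-△⁺ʳ : ¬ Edge G x y → Edge S x y → Edge (G △ S) x y
    Edge-△⁺ʳ ¬g s = subst T (sym (adj-fromAdj _ x y)) (T-xor⁺ʳ (adj G x y) (adj S x y) ¬g s)

module Exchange {N : ℕ} {W : Subset N} {G S : Graph N} {a b c : Fin N}
  (isG : IsGraph G) (G⊆W : EdgesIn W G) (G-acyclic : Acyclic G) (G-two : TwoComponents W G)
  (isS : IsGraph S) (S⇒ : Edge S ⇒ IsPair a b ∪ IsPair a c) (Sab : Edge S a b) (Sac : Edge S a c)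
  (Gab : Edge G a b) (c∈W : c ∈ W) (b↮c : ¬ Conn G b c) where

  open GraphProperties G isG

  private
    G′ : Graph N
    G′ = G △ S

    Common : Rel (Fin N) 0ℓ
    Common x y = Edge G x y × ¬ Edge S x y

    a∈W : a ∈ W
    a∈W = proj₁ (G⊆W a b Gab)

    b∈W : b ∈ W
    b∈W = proj₂ (G⊆W a b Gab)

    ¬Gac : ¬ Edge G a c
    ¬Gac Gac = b↮c (Edge-sym Gab ◅ Gac ◅ ε)

    G⇒ : Edge G ⇒ Common ∪ IsPair a b
    G⇒ {x} {y} g with T? (adj S x y)
    ... | no ¬s = inj₁ (g , ¬s)
    ... | yes s with S⇒ s
    ...   | inj₁ ab = inj₂ ab
    ...   | inj₂ ac = ⊥-elim (¬Gac (Edge-IsPair⁻ ac g))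

    G′⇒ : Edge G′ ⇒ Common ∪ IsPair a c
    G′⇒ e with Edge-△⁻ G S e
    ... | inj₁ common = inj₁ common
    ... | inj₂ (s , ¬g) with S⇒ s
    ...   | inj₁ ab = ⊥-elim (¬g (Edge-IsPair⁺ ab Gab))
    ...   | inj₂ ac = inj₂ ac

    Common-sym : Symmetric Common
    Common-sym (g , ¬s) = Edge-sym g , ¬s ∘ GraphProperties.Edge-sym S isS

    Common-acyclic : ¬ Cyclic Common
    Common-acyclic (v , ws , len , u , l) = G-acyclic (v , ws , len , u , Linked.map proj₁ l)

    Common⇒G′ : Common ⇒ Edge G′
    Common⇒G′ (g , ¬s) = Edge-△⁺ˡ G S g ¬s

    G′ac : Edge G′ a c
    G′ac = Edge-△⁺ʳ G S ¬Gac Sac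

    a↮ᶜb : ¬ Star Common a b
    a↮ᶜb = ¬Star-across-bridge _≟_ proj₁ G-acyclic (Edge-sym Gab) (λ common → proj₂ common Sab)
                                (Edge-irrefl Gab)

    a↮ᶜc : ¬ Star Common a c
    a↮ᶜc a⋯c = b↮c (Edge-sym Gab ◅ Star.map proj₁ a⋯c)

    G′-acyclic : Acyclic G′
    G′-acyclic = acyclic-join _≟_ G′⇒ Common-sym Common-acyclic a↮ᶜc

    G′⊆W : EdgesIn W G′
    G′⊆W i j e with G′⇒ e
    ... | inj₁ (g , _)              = G⊆W i j g
    ... | inj₂ (inj₁ (refl , refl)) = a∈W , c∈W
    ... | inj₂ (inj₂ (refl , refl)) = c∈W , a∈W

    G′-a↮b : ¬ Conn G′ a b
    G′-a↮b a⋯b with Star-split G′⇒ a⋯b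
    ... | inj₁ a⋯ᶜb              = a↮ᶜb a⋯ᶜb
    ... | inj₂ (inj₁ (_ , c⋯ᶜb)) = b↮c (Conn-sym (Star.map proj₁ c⋯ᶜb))
    ... | inj₂ (inj₂ (_ , a⋯ᶜb)) = a↮ᶜb a⋯ᶜb

    lift : ∀ {x y} → Star Common x y → Conn G′ x y
    lift = Star.map Common⇒G′

    G′-cover : ∀ v → v ∈ W → Conn G′ a v ⊎ Conn G′ b v
    G′-cover v v∈W with TwoComponents-cover G-two b∈W c∈W b↮c v v∈W
    ... | inj₁ b⋯v = from-b (Star-split G⇒ b⋯v)
      where
      from-b : StarVia Common a b b v → Conn G′ a v ⊎ Conn G′ b v
      from-b (inj₁ p)              = inj₂ (lift p)
      from-b (inj₂ (inj₁ (_ , p))) = inj₂ (lift p)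
      from-b (inj₂ (inj₂ (_ , p))) = inj₁ (lift p)
    ... | inj₂ c⋯v = from-c (Star-split G⇒ c⋯v)
      where
      from-c : StarVia Common a b c v → Conn G′ a v ⊎ Conn G′ b v
      from-c (inj₁ p)              = inj₁ (G′ac ◅ lift p)
      from-c (inj₂ (inj₁ (_ , p))) = inj₂ (lift p)
      from-c (inj₂ (inj₂ (_ , p))) = inj₁ (lift p)

  exchange : InF2 W (G △ S) × Edge (G △ S) a c × ¬ Conn (G △ S) a b
  exchange = (IsGraph-△ {G = G} {S} isG isS , G′⊆W , G′-acyclic , (a , b , a∈W , b∈W , G′-a↮b , G′-cover))
           , G′ac , G′-a↮b

module _ {k : ℕ} where

  private
    Vertex : Set
    Vertex = Fin (4 + k)

  is3 : Vertex → Bool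
  is3 (suc (suc zero)) = true
  is3 _                = false

  is2or4 : Vertex → Bool
  is2or4 (suc zero)             = true
  is2or4 (suc (suc (suc zero))) = true
  is2or4 _                      = false

  is3⇒≡v3 : ∀ x → T (is3 x) → x ≡ v3
  is3⇒≡v3 (suc (suc zero)) _ = refl

  is2or4⇒≡v2⊎≡v4 : ∀ x → T (is2or4 x) → x ≡ v2 ⊎ x ≡ v4
  is2or4⇒≡v2⊎≡v4 (suc zero)             _ = inj₁ refl
  is2or4⇒≡v2⊎≡v4 (suc (suc (suc zero))) _ = inj₂ refl

  is3∧is2or4≡false : ∀ x → is3 x ∧ is2or4 x ≡ false
  is3∧is2or4≡false zero                         = refl
  is3∧is2or4≡false (suc zero)                   = refl
  is3∧is2or4≡false (suc (suc zero))             = refl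
  is3∧is2or4≡false (suc (suc (suc zero)))       = refl
  is3∧is2or4≡false (suc (suc (suc (suc _))))    = refl

  path-adj : Vertex → Vertex → Bool
  path-adj x y = (is3 x ∧ is2or4 y) ∨ (is2or4 x ∧ is3 y)

  path234 : Graph (4 + k)
  path234 = fromAdj path-adj

  IsGraph-path234 : IsGraph path234
  IsGraph-path234 = IsGraph-fromAdj {f = path-adj}
    (λ x y → trans (cong₂ _∨_ (∧-comm (is3 x) (is2or4 y)) (∧-comm (is2or4 x) (is3 y)))
                   (∨-comm (is2or4 y ∧ is3 x) (is3 y ∧ is2or4 x)))
    (λ x → cong₂ _∨_ (is3∧is2or4≡false x) (trans (∧-comm (is2or4 x) _) (is3∧is2or4≡false x)))

  path234-edges : Edge path234 ⇒ IsPair v3 v2 ∪ IsPair v3 v4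
  path234-edges {x} {y} e with Equivalence.to T-∨ (subst T (adj-fromAdj path-adj x y) e)
  ... | inj₁ 3∧2or4 = hub-leaf (Equivalence.to T-∧ 3∧2or4)
    where
    hub-leaf : T (is3 x) × T (is2or4 y) → IsPair v3 v2 x y ⊎ IsPair v3 v4 x y
    hub-leaf (h , l) with is3⇒≡v3 x h | is2or4⇒≡v2⊎≡v4 y l
    ... | x≡3 | inj₁ y≡2 = inj₁ (inj₁ (x≡3 , y≡2))
    ... | x≡3 | inj₂ y≡4 = inj₂ (inj₁ (x≡3 , y≡4))
  ... | inj₂ 2or4∧3 = leaf-hub (Equivalence.to T-∧ 2or4∧3)
    where
    leaf-hub : T (is2or4 x) × T (is3 y) → IsPair v3 v2 x y ⊎ IsPair v3 v4 x y
    leaf-hub (l , h) with is2or4⇒≡v2⊎≡v4 x l | is3⇒≡v3 y h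
    ... | inj₁ x≡2 | y≡3 = inj₁ (inj₂ (x≡2 , y≡3))
    ... | inj₂ x≡4 | y≡3 = inj₂ (inj₂ (x≡4 , y≡3))

  module _ {W : Subset (4 + k)} {G : Graph (4 + k)} where

    InF'⇒InF''-△path234 : v4 ∈ W → InF' W G → InF'' W (G △ path234)
    InF'⇒InF''-△path234 4∈W ((isG , G⊆W , G-acyclic , G-two) , e12 , e23 , 1↮4)
      with Exchange.exchange {W = W} {G = G} {S = path234} {a = v3} {b = v2} {c = v4}
             isG G⊆W G-acyclic G-two IsGraph-path234 path234-edges _ _
             (Edge-sym e23) 4∈W (λ 2⋯4 → 1↮4 (e12 ◅ 2⋯4))
      where open GraphProperties G isG
    ... | F₂′@(isG′ , _) , e34′ , 3↮2 = F₂′ , e12′ , e34′ , 1↮3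
      where
      open GraphProperties (G △ path234) isG′
      e12′ : Edge (G △ path234) v1 v2
      e12′ = Edge-△⁺ˡ G path234 e12 λ ()
      1↮3 : ¬ Conn (G △ path234) v1 v3
      1↮3 1⋯3 = 3↮2 (Conn-sym 1⋯3 ◅◅ (e12′ ◅ ε))

    InF''⇒InF'-△path234 : v2 ∈ W → InF'' W G → InF' W (G △ path234)
    InF''⇒InF'-△path234 2∈W ((isG , G⊆W , G-acyclic , G-two) , e12 , e34 , 1↮3)
      with Exchange.exchange {W = W} {G = G} {S = path234} {a = v3} {b = v4} {c = v2}
             isG G⊆W G-acyclic G-two IsGraph-path234 (Sum.swap ∘ path234-edges) _ _
             e34 2∈W 4↮2
      where
      open GraphProperties G isG
      4↮2 : ¬ Conn G v4 v2
      4↮2 4⋯2 = 1↮3 (e12 ◅ Conn-sym 4⋯2 ◅◅ (Edge-sym e34 ◅ ε))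
    ... | F₂′@(isG′ , _) , e32′ , 3↮4 = F₂′ , e12′ , Edge-sym {v3} {v2} e32′ , 1↮4
      where
      open GraphProperties (G △ path234) isG′
      e12′ : Edge (G △ path234) v1 v2
      e12′ = Edge-△⁺ˡ G path234 e12 λ ()
      1↮4 : ¬ Conn (G △ path234) v1 v4
      1↮4 1⋯4 = 3↮4 (e32′ ◅ Conn-sym {v1} {v2} (e12′ ◅ ε) ◅◅ 1⋯4)

lemma2p8 : (k : ℕ) (W : Subset (4 + k)) →
    v1 ∈ W → v2 ∈ W → v3 ∈ W → v4 ∈ W →
    Refinement (Graph (4 + k)) (InF' W) ↔ Refinement (Graph (4 + k)) (InF'' W)
lemma2p8 k W _ 2∈W _ 4∈W =
  mk↔ₛ′ (Refinement.map (_△ path234) (λ {G} → InF'⇒InF''-△path234 {G = G} 4∈W))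
        (Refinement.map (_△ path234) (λ {G} → InF''⇒InF'-△path234 {G = G} 2∈W))
        (λ G″ → value-injective (△-cancelʳ (value G″) path234))
        (λ G′ → value-injective (△-cancelʳ (value G′) path234))
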